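{- Let $G$ be a connected outerplanar graph with at least two vertices. Then $pd(G)=1$ if and only if $G$ contains no triangle.
   Context: All graphs are simple, finite and undirected. A graph is outerplanar if it can be drawn in the plane without crossings so that all vertices lie on the unbounded face. For an edge-coloring $c$ of a graph $G$, a set $F\subseteq E(G)$ is a proper cut if $G-F$ is disconnected and any two edges of $F$ sharing an endpoint receive different colors. A proper cut $F$ separates two vertices $x,y$ if $x$ and $y$ lie in different components of $G-F$. An edge-colored graph is proper disconnected if for every pair of distinct vertices there is a proper cut separating them. For a connected graph $G$, the proper disconnection number $pd(G)$ is the minimum $k$ such that there is an edge-coloring $c:E(G)\to\{1,\dots,k\}$ making $G$ proper disconnected. -}

module Defs where

open import Data.Nat using (ℕ; _≤_)
open import Data.Fin using (Fin; toℕ)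
open import Data.Bool using (Bool; T)
open import Data.Product using (Σ; ∃; ∃-syntax; _×_; _,_)
open import Data.Empty using (⊥)
open import Relation.Nullary using (¬_)
open import Relation.Binary.PropositionalEquality using (_≡_; _≢_)
open import Function.Definitions using (Injective)
open import Function.Bundles using (_⇔_)
open import Data.Nat using (_<_)

record Graph : Set where
  field
    n      : ℕ
    adj    : Fin n → Fin n → Bool
    sym    : ∀ u v → adj u v ≡ adj v u
    irrefl : ∀ u → adj u u ≡ Data.Bool.false

open Graph public

Edge : (G : Graph) → Fin (n G) → Fin (n G) → Set
Edge G u v = T (adj G u v)

data Reach {m : ℕ} (R : Fin m → Fin m → Set) : Fin m → Fin m → Set where
  here : ∀ {x} → Reach R x x
  step : ∀ {x y z} → R x y → Reach R y z → Reach R x z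

Connected : Graph → Set
Connected G = ∀ x y → Reach (Edge G) x y

-- G contains a triangle (distinctness of a, b, c follows from irreflexivity).
HasTriangle : Graph → Set
HasTriangle G = Σ (Fin (n G)) λ a → Σ (Fin (n G)) λ b → Σ (Fin (n G)) λ c →
  Edge G a b × Edge G b c × Edge G a c

-- Outerplanarity, combinatorially: the vertices can be placed in some cyclic
-- order on a circle (pos is a bijection Fin n → Fin n) so that no two edges
-- cross as chords (one-page book embedding / convex outerplanar drawing).
Outerplanar : Graph → Set
Outerplanar G = Σ (Fin (n G) → Fin (n G)) λ pos → Injective _≡_ _≡_ pos ×
  (∀ a b c d → Edge G a b → Edge G c d →
     ¬ (toℕ (pos a) < toℕ (pos c) × toℕ (pos c) < toℕ (pos b) × toℕ (pos b) < toℕ (pos d)))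

record Coloring (G : Graph) (k : ℕ) : Set where
  field
    col     : (u v : Fin (n G)) → Edge G u v → Fin k
    col-sym : ∀ u v (e : Edge G u v) (e' : Edge G v u) → col u v e ≡ col v u e'

open Coloring public

record EdgeSet (G : Graph) : Set where
  field
    mem     : Fin (n G) → Fin (n G) → Bool
    mem-sym : ∀ u v → mem u v ≡ mem v u
    mem-sub : ∀ u v → T (mem u v) → Edge G u v

open EdgeSet public

Minus : (G : Graph) → EdgeSet G → Fin (n G) → Fin (n G) → Set
Minus G F u v = Edge G u v × ¬ T (mem F u v)

Disconnected-minus : (G : Graph) → EdgeSet G → Set
Disconnected-minus G F = ∃[ x ] ∃[ y ] ¬ Reach (Minus G F) x y

ProperlyColoured : {G : Graph} {k : ℕ} → Coloring G k → EdgeSet G → Set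
ProperlyColoured {G} c F = ∀ u v w → v ≢ w →
  (e₁ : Edge G u v) (e₂ : Edge G u w) → T (mem F u v) → T (mem F u w) →
  col c u v e₁ ≢ col c u w e₂

ProperCut : {G : Graph} {k : ℕ} → Coloring G k → EdgeSet G → Set
ProperCut {G} c F = Disconnected-minus G F × ProperlyColoured c F

Separates : (G : Graph) → EdgeSet G → Fin (n G) → Fin (n G) → Set
Separates G F x y = ¬ Reach (Minus G F) x y

ProperDisconnected : {G : Graph} {k : ℕ} → Coloring G k → Set
ProperDisconnected {G} c = ∀ x y → x ≢ y →
  Σ (EdgeSet G) λ F → ProperCut c F × Separates G F x y

PDColourable : Graph → ℕ → Set
PDColourable G k = Σ (Coloring G k) ProperDisconnected

PD≡ : Graph → ℕ → Set
PD≡ G k = PDColourable G k × (∀ j → j < k → ¬ PDColourable G j)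

-- A proper cut with one colour is a matching. If abd is a triangle, a cut separating a from b
-- contains ab, hence neither ad nor bd, so the path a d b survives.
-- Conversely, in a triangle-free outerplanar graph any two vertices x, y are separated by a
-- matching cut, by induction on induced subgraphs. Drawing the vertices on a line, the shortest
-- edge passing over some vertex shows that every nonempty induced subgraph has a vertex k of
-- degree at most one, or adjacent vertices u, w whose other neighbours are single vertices
-- a ≠ b. Delete k, resp. u and w, separate recursively, and put k on the side of its neighbour,
-- resp. u on the side of a and w on the side of b; if this puts x and y on the same side, the
-- cut around {k}, resp. {u, w}, separates them.
module Submission where

open import Defs
open import Data.Nat using (_≤_)
open import Relation.Nullary using (¬_)
open import Function.Bundles using (_⇔_)

open import Data.Bool using (Bool; true; false; not; _∧_; _∨_; _xor_; T)
open import Data.Bool.Properties using (T-∧; xor-comm; ∨-zeroʳ)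
open import Data.Empty using (⊥-elim)
open import Data.Fin using (Fin; zero; suc; toℕ; _≟_)
open import Data.Fin.Properties using (any?; ¬Fin0; toℕ-injective)
open import Data.Fin.Subset using (Subset; _∈_; _-_; ∣_∣; ⊤)
open import Data.Fin.Subset.Properties using (_∈?_; ∈⊤; x∈p∧x≢y⇒x∈p-y; x∈p⇒∣p-x∣<∣p∣)
open import Data.Nat using (ℕ; _<_; _∸_; _<?_; z≤n; s≤s)
open import Data.Nat.Induction using (<-wellFounded)
open import Data.Nat.Properties
  using (<-cmp; <-trans; ≤-trans; <⇒≤; <⇒≢; ≮⇒≥; <⇒≱; ≤∧≢⇒<; ≤-<-trans; <-≤-trans;
         ∸-monoˡ-≤; ∸-monoʳ-≤; ∸-monoˡ-<; ∸-monoʳ-<)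
open import Data.Product using (Σ; Σ-syntax; ∃; ∃₂; _×_; _,_; proj₁; proj₂; uncurry)
open import Data.Sum using (_⊎_; inj₁; inj₂; [_,_]′)
open import Data.Vec.Functional using (updateAt)
open import Data.Vec.Functional.Properties using (updateAt-updates; updateAt-minimal)
open import Function using (_∘_; id; const; _on_)
open import Function.Bundles using (mk⇔; Equivalence)
open import Induction.WellFounded using (Acc; acc)
open import Relation.Binary.Construct.On using () renaming (wellFounded to on-wellFounded)
open import Relation.Binary.Definitions using (tri<; tri≈; tri>)
open import Relation.Binary.PropositionalEquality
  using (_≡_; _≢_; refl; trans; cong; cong₂; subst; ≢-sym) renaming (sym to ≡-sym)
open import Relation.Nullary using (Dec; yes; no; does)
open import Relation.Nullary.Decidable using (_×-dec_; map′; T?; dec-true; dec-false; decidable-stable)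

minimal : {X : Set} {Q : X → Set} (f : X → ℕ) → (∀ x → Dec (∃ λ y → Q y × f y < f x)) →
  ∀ {x} → Q x → ∃ λ x₀ → Q x₀ × (∀ {y} → Q y → f x₀ ≤ f y)
minimal {Q = Q} f smaller? {x} = descend (on-wellFounded f <-wellFounded x)
  where
  descend : ∀ {x} → Acc (_<_ on f) x → Q x → ∃ λ x₀ → Q x₀ × (∀ {y} → Q y → f x₀ ≤ f y)
  descend {x} (acc below) qx with smaller? x
  ... | yes (y , qy , fy<fx) = descend (below fy<fx) qy
  ... | no none = x , qx , λ qy → ≮⇒≥ (λ fy<fx → none (_ , qy , fy<fx))

nested-interval-shorter : ∀ {a b c d} → a ≤ c → d ≤ b → a < c ⊎ d < b → c < d → d ∸ c < b ∸ a
nested-interval-shorter {a} {b} {c} {d} a≤c d≤b (inj₁ a<c) c<d =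
  ≤-<-trans (∸-monoˡ-≤ c d≤b) (∸-monoʳ-< a<c (≤-trans (<⇒≤ c<d) d≤b))
nested-interval-shorter {a} {b} {c} {d} a≤c d≤b (inj₂ d<b) c<d =
  <-≤-trans (∸-monoˡ-< d<b (<⇒≤ c<d)) (∸-monoʳ-≤ b a≤c)

sides-differ : ∀ {b c : Bool} → b ≡ true → c ≡ false → b ≢ c
sides-differ refl refl ()

reach-edge : ∀ {m} {R : Fin m → Fin m → Set} {x y} → Reach R x y → x ≢ y → ∃₂ R
reach-edge here x≢x = ⊥-elim (x≢x refl)
reach-edge (step r _) _ = _ , _ , r

two-distinct : ∀ {m} → 2 ≤ m → ∃₂ λ (x y : Fin m) → x ≢ y
two-distinct (s≤s (s≤s z≤n)) = zero , suc zero , λ ()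

Fin1-unique : (i j : Fin 1) → i ≡ j
Fin1-unique zero zero = refl

module _ (G : Graph) where

  private
    V : Set
    V = Fin (n G)

  Edge-sym : ∀ {u v} → Edge G u v → Edge G v u
  Edge-sym {u} {v} = subst T (Graph.sym G u v)

  Edge-irrefl : ∀ {u v} → Edge G u v → u ≢ v
  Edge-irrefl {u} e refl = subst T (irrefl G u) e

  Pendant : Subset (n G) → V → V → Set
  Pendant A k m = ∀ {v} → v ∈ A → Edge G k v → v ≡ m

  MatchingCut : Subset (n G) → (V → Bool) → Set
  MatchingCut A S = ∀ {z} → z ∈ A → ∃ λ m → ∀ {v} → v ∈ A → Edge G z v → S z ≢ S v → v ≡ m

  Separation : Subset (n G) → V → V → Set
  Separation A x y = Σ[ S ∈ (V → Bool) ] S x ≡ true × S y ≡ false × MatchingCut A S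

  Separable : Subset (n G) → Set
  Separable A = ∀ {x y} → x ∈ A → y ∈ A → x ≢ y → Separation A x y

  matchingCut-not : ∀ {A S} → MatchingCut A S → MatchingCut A (not ∘ S)
  matchingCut-not cut z∈A with cut z∈A
  ... | m , only = m , λ v∈A e crosses → only v∈A e (crosses ∘ cong not)

  separation-from-≢ : ∀ {A S x y} → MatchingCut A S → S x ≢ S y → Separation A x y
  separation-from-≢ {S = S} {x} {y} cut Sx≢Sy with S x in Sx | S y in Sy
  ... | true  | false = S , Sx , Sy , cut
  ... | false | true  = not ∘ S , cong not Sx , cong not Sy , matchingCut-not cut
  ... | true  | true  = ⊥-elim (Sx≢Sy refl)
  ... | false | false = ⊥-elim (Sx≢Sy refl)

  isolate : V → V → Bool
  isolate k v = does (v ≟ k)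

  isolate-here : ∀ k → isolate k k ≡ true
  isolate-here k = dec-true (k ≟ k) refl

  isolate-there : ∀ {k v} → v ≢ k → isolate k v ≡ false
  isolate-there {k} {v} = dec-false (v ≟ k)

  isolate-matchingCut : ∀ {A k m} → Pendant A k m → MatchingCut A (isolate k)
  isolate-matchingCut {k = k} {m} pendant {z} z∈A with z ≟ k
  ... | yes refl = m , λ v∈A e _ → pendant v∈A e
  ... | no _ = k , λ {v} _ _ crosses →
    decidable-stable (v ≟ k) (λ v≢k → crosses (≡-sym (isolate-there v≢k)))

  redirect : V → V → V → V
  redirect k m = updateAt id k (const m)

  redirect-here : ∀ {k m} → redirect k m k ≡ m
  redirect-here {k} = updateAt-updates k id

  redirect-there : ∀ {k m v} → v ≢ k → redirect k m v ≡ v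
  redirect-there {k} {m} {v} = updateAt-minimal v k id

  Fixed : Subset (n G) → (V → V) → V → Set
  Fixed A′ ρ z = z ∈ A′ × ρ z ≡ z

  record Pullback (A A′ : Subset (n G)) (ρ : V → V) : Set where
    field
      fixed-or-moved : ∀ {z} → z ∈ A →
        Fixed A′ ρ z ⊎ ∃ λ m → ∀ {v} → v ∈ A → Edge G z v → ρ z ≢ ρ v → v ≡ m
      fixed-neighbour : ∀ {z} → z ∈ A → Fixed A′ ρ z → ∀ {v} → v ∈ A → Edge G z v →
        Fixed A′ ρ v ⊎ ρ v ≡ z

  pullback-matchingCut : ∀ {A A′ ρ S} → Pullback A A′ ρ → MatchingCut A′ S → MatchingCut A (S ∘ ρ)
  pullback-matchingCut {A} {A′} {ρ} {S} pb cut {z} z∈A with Pullback.fixed-or-moved pb z∈A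
  ... | inj₂ (m , only) = m , λ v∈A e crosses → only v∈A e (crosses ∘ cong S)
  ... | inj₁ (z∈A′ , ρz≡z) with cut z∈A′
  ...   | m , only = m , crossing
    where
    crossing : ∀ {v} → v ∈ A → Edge G z v → S (ρ z) ≢ S (ρ v) → v ≡ m
    crossing v∈A e crosses with Pullback.fixed-neighbour pb z∈A (z∈A′ , ρz≡z) v∈A e
    ... | inj₁ (v∈A′ , ρv≡v) =
      only v∈A′ e (λ Sz≡Sv → crosses (trans (cong S ρz≡z) (trans Sz≡Sv (cong S (≡-sym ρv≡v)))))
    ... | inj₂ ρv≡z = ⊥-elim (crosses (cong S (trans ρz≡z (≡-sym ρv≡z))))

  pendant-pullback : ∀ {A k m} → Pendant A k m → Pullback A (A - k) (redirect k m)
  pendant-pullback {k = k} {m} pendant .Pullback.fixed-or-moved {z} z∈A with z ≟ k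
  ... | yes refl = inj₂ (m , λ v∈A e _ → pendant v∈A e)
  ... | no z≢k = inj₁ (x∈p∧x≢y⇒x∈p-y z∈A z≢k , redirect-there z≢k)
  pendant-pullback {k = k} {m} pendant .Pullback.fixed-neighbour z∈A _ {v} v∈A e with v ≟ k
  ... | yes refl = inj₂ (trans redirect-here (≡-sym (pendant z∈A (Edge-sym e))))
  ... | no v≢k = inj₁ (x∈p∧x≢y⇒x∈p-y v∈A v≢k , redirect-there v≢k)

  pendant-separable : ∀ {A k m} → k ∈ A → Pendant A k m → Separable (A - k) → Separable A
  pendant-separable {k = k} {m} k∈A pendant separable′ {x} {y} x∈A y∈A x≢y with x ≟ k | y ≟ k
  ... | yes refl | _ =
    separation-from-≢ (isolate-matchingCut pendant)
      (sides-differ (isolate-here k) (isolate-there (≢-sym x≢y)))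
  ... | no x≢k | yes refl =
    separation-from-≢ (isolate-matchingCut pendant)
      (≢-sym (sides-differ (isolate-here k) (isolate-there x≢k)))
  ... | no x≢k | no y≢k with separable′ (x∈p∧x≢y⇒x∈p-y x∈A x≢k) (x∈p∧x≢y⇒x∈p-y y∈A y≢k) x≢y
  ...   | S , Sx , Sy , cut =
    S ∘ redirect k m , trans (cong S (redirect-there x≢k)) Sx , trans (cong S (redirect-there y≢k)) Sy ,
    pullback-matchingCut (pendant-pullback pendant) cut

  record SuspendedPath (A : Subset (n G)) : Set where
    field
      u w a b : V
      u∈A : u ∈ A
      w∈A : w ∈ A
      a∈A : a ∈ A
      b∈A : b ∈ A
      edge-au : Edge G a u
      edge-uw : Edge G u w
      edge-wb : Edge G w b
      a≢w : a ≢ w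
      b≢u : b ≢ u
      a≢b : a ≢ b
      neighbours-u : ∀ {v} → v ∈ A → Edge G u v → v ≡ w ⊎ v ≡ a
      neighbours-w : ∀ {v} → v ∈ A → Edge G w v → v ≡ u ⊎ v ≡ b

  module _ {A : Subset (n G)} (path : SuspendedPath A) where

    open SuspendedPath path

    private
      u≢w : u ≢ w
      u≢w = Edge-irrefl edge-uw

      a≢u : a ≢ u
      a≢u = Edge-irrefl edge-au

      b≢w : b ≢ w
      b≢w = ≢-sym (Edge-irrefl edge-wb)

      ∈A⁻ : ∀ {v} → v ∈ A → v ≢ u → v ≢ w → v ∈ A - u - w
      ∈A⁻ v∈A v≢u v≢w = x∈p∧x≢y⇒x∈p-y (x∈p∧x≢y⇒x∈p-y v∈A v≢u) v≢w

    contract : V → V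
    contract = redirect u a ∘ redirect w b

    private
      contract-u : contract u ≡ a
      contract-u = trans (cong (redirect u a) (redirect-there u≢w)) redirect-here

      contract-w : contract w ≡ b
      contract-w = trans (cong (redirect u a) redirect-here) (redirect-there b≢u)

      contract-there : ∀ {v} → v ≢ u → v ≢ w → contract v ≡ v
      contract-there v≢u v≢w = trans (cong (redirect u a) (redirect-there v≢w)) (redirect-there v≢u)

    contract-∈ : ∀ {v} → v ∈ A → contract v ∈ A - u - w
    contract-∈ {v} v∈A with v ≟ u | v ≟ w
    ... | yes refl | _ = subst (_∈ A - u - w) (≡-sym contract-u) (∈A⁻ a∈A a≢u a≢w)
    ... | no _ | yes refl = subst (_∈ A - u - w) (≡-sym contract-w) (∈A⁻ b∈A b≢u b≢w)
    ... | no v≢u | no v≢w = subst (_∈ A - u - w) (≡-sym (contract-there v≢u v≢w)) (∈A⁻ v∈A v≢u v≢w)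

    contract-pullback : Pullback A (A - u - w) contract
    contract-pullback .Pullback.fixed-or-moved {z} z∈A with z ≟ u | z ≟ w
    ... | yes refl | _ = inj₂ (w , λ v∈A e separated →
      [ id , (λ { refl → ⊥-elim (separated (trans contract-u (≡-sym (contract-there a≢u a≢w)))) }) ]′
        (neighbours-u v∈A e))
    ... | no _ | yes refl = inj₂ (u , λ v∈A e separated →
      [ id , (λ { refl → ⊥-elim (separated (trans contract-w (≡-sym (contract-there b≢u b≢w)))) }) ]′
        (neighbours-w v∈A e))
    ... | no z≢u | no z≢w = inj₁ (∈A⁻ z∈A z≢u z≢w , contract-there z≢u z≢w)
    contract-pullback .Pullback.fixed-neighbour {z} z∈A (_ , fixed) {v} v∈A e with v ≟ u | v ≟ w
    ... | yes refl | _ = inj₂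
      ([ (λ { refl → ⊥-elim (b≢w (trans (≡-sym contract-w) fixed)) })
       , (λ z≡a → trans contract-u (≡-sym z≡a)) ]′
        (neighbours-u z∈A (Edge-sym e)))
    ... | no _ | yes refl = inj₂
      ([ (λ { refl → ⊥-elim (a≢u (trans (≡-sym contract-u) fixed)) })
       , (λ z≡b → trans contract-w (≡-sym z≡b)) ]′
        (neighbours-w z∈A (Edge-sym e)))
    ... | no v≢u | no v≢w = inj₁ (∈A⁻ v∈A v≢u v≢w , contract-there v≢u v≢w)

    pair : V → Bool
    pair v = isolate u v ∨ isolate w v

    private
      pair-u : pair u ≡ true
      pair-u = cong (_∨ isolate w u) (isolate-here u)

      pair-w : pair w ≡ true
      pair-w = trans (cong (isolate u w ∨_) (isolate-here w)) (∨-zeroʳ (isolate u w))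

      pair-crossing : ∀ {v} → false ≢ pair v → v ≡ u ⊎ v ≡ w
      pair-crossing {v} crosses with v ≟ u | v ≟ w
      ... | yes v≡u | _ = inj₁ v≡u
      ... | no _ | yes v≡w = inj₂ v≡w
      ... | no _ | no _ = ⊥-elim (crosses refl)

    pair-matchingCut : MatchingCut A pair
    pair-matchingCut {z} z∈A with z ≟ u | z ≟ w
    ... | yes refl | _ = a , λ v∈A e crosses →
      [ (λ { refl → ⊥-elim (crosses (≡-sym pair-w)) }) , id ]′ (neighbours-u v∈A e)
    ... | no _ | yes refl = b , λ v∈A e crosses →
      [ (λ { refl → ⊥-elim (crosses (≡-sym pair-u)) }) , id ]′ (neighbours-w v∈A e)
    ... | no z≢u | no z≢w with z ≟ a
    ...   | yes refl = u , λ v∈A e crosses →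
      [ id , (λ { refl → ⊥-elim ([ z≢u , a≢b ]′ (neighbours-w z∈A (Edge-sym e))) }) ]′ (pair-crossing crosses)
    ...   | no z≢a = w , λ v∈A e crosses →
      [ (λ { refl → ⊥-elim ([ z≢w , z≢a ]′ (neighbours-u z∈A (Edge-sym e))) }) , id ]′ (pair-crossing crosses)

    -- contract identifies only u with a and w with b, and pair separates both.
    pair-separates : ∀ {x y} → contract x ≡ contract y → x ≢ y → pair x ≢ pair y
    pair-separates {x} {y} same x≢y with x ≟ u | x ≟ w | y ≟ u | y ≟ w
    ... | yes refl | _ | yes refl | _ = ⊥-elim (x≢y refl)
    ... | yes refl | _ | no _ | yes refl = ⊥-elim (a≢b (trans (≡-sym contract-u) (trans same contract-w)))
    ... | yes refl | _ | no y≢u | no y≢w = λ ()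
    ... | no _ | yes refl | yes refl | _ =
      ⊥-elim (a≢b (trans (≡-sym contract-u) (trans (≡-sym same) contract-w)))
    ... | no _ | yes refl | no _ | yes refl = ⊥-elim (x≢y refl)
    ... | no _ | yes refl | no y≢u | no y≢w = λ ()
    ... | no x≢u | no x≢w | yes refl | _ = λ ()
    ... | no x≢u | no x≢w | no _ | yes refl = λ ()
    ... | no x≢u | no x≢w | no y≢u | no y≢w =
      ⊥-elim (x≢y (trans (≡-sym (contract-there x≢u x≢w)) (trans same (contract-there y≢u y≢w))))

    suspended-separable : Separable (A - u - w) → Separable A
    suspended-separable separable′ {x} {y} x∈A y∈A x≢y with contract x ≟ contract y
    ... | yes same = separation-from-≢ pair-matchingCut (pair-separates same x≢y)
    ... | no different with separable′ (contract-∈ x∈A) (contract-∈ y∈A) different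
    ...   | S , Sx , Sy , cut = S ∘ contract , Sx , Sy , pullback-matchingCut contract-pullback cut

  data Reduction (A : Subset (n G)) : Set where
    pendant : ∀ {k m} → k ∈ A → Pendant A k m → Reduction A
    suspended : SuspendedPath A → Reduction A

  Reducible : Set
  Reducible = ∀ {A z} → z ∈ A → Reduction A

  separable : Reducible → ∀ A → Separable A
  separable reducible A = separable-acc (on-wellFounded ∣_∣ <-wellFounded A)
    where
    separable-acc : ∀ {A} → Acc (_<_ on ∣_∣) A → Separable A
    separable-acc {A} (acc smaller) x∈A with reducible x∈A
    ... | pendant k∈A k-pendant =
      pendant-separable k∈A k-pendant (separable-acc (smaller (x∈p⇒∣p-x∣<∣p∣ k∈A))) x∈A
    ... | suspended path = suspended-separable path (separable-acc (smaller size-decreases)) x∈A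
      where
      open SuspendedPath path
      size-decreases : ∣ A - u - w ∣ < ∣ A ∣
      size-decreases =
        <-trans (x∈p⇒∣p-x∣<∣p∣ (x∈p∧x≢y⇒x∈p-y w∈A (≢-sym (Edge-irrefl edge-uw)))) (x∈p⇒∣p-x∣<∣p∣ u∈A)

-- Vertices sit at distinct points P v of a line, edges are pairwise non-crossing arcs above it.
module ConvexDrawing (G : Graph) (P : Fin (n G) → ℕ) (P-injective : ∀ {u v} → P u ≡ P v → u ≡ v)
  (noncrossing : ∀ {a b c d} → Edge G a b → Edge G c d → ¬ (P a < P c × P c < P b × P b < P d)) where

  private
    V : Set
    V = Fin (n G)

  distinct : ∀ {u v} → P u < P v → u ≢ v
  distinct Pu<Pv u≡v = <⇒≢ Pu<Pv (cong P u≡v)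

  neighbour-side : ∀ {c s} → Edge G c s → P s < P c ⊎ P c < P s
  neighbour-side {c} {s} e with <-cmp (P s) (P c)
  ... | tri< s<c _ _ = inj₁ s<c
  ... | tri≈ _ s≡c _ = ⊥-elim (Edge-irrefl G e (≡-sym (P-injective s≡c)))
  ... | tri> _ _ c<s = inj₂ c<s

  under-chord : ∀ {i j c s} → Edge G i j → P i < P c → P c < P j → Edge G c s → P i ≤ P s × P s ≤ P j
  under-chord i∼j i<c c<j c∼s =
    ≮⇒≥ (λ s<i → noncrossing (Edge-sym G c∼s) i∼j (s<i , i<c , c<j)) ,
    ≮⇒≥ (λ j<s → noncrossing i∼j c∼s (i<c , c<j , j<s))

  module _ (A : Subset (n G)) where

    by-side : ∀ {c} {Q : V → Set} →
      (∀ {s} → s ∈ A → Edge G c s → P s < P c → Q s) →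
      (∀ {s} → s ∈ A → Edge G c s → P c < P s → Q s) →
      ∀ {s} → s ∈ A → Edge G c s → Q s
    by-side left right s∈A e = [ left s∈A e , right s∈A e ]′ (neighbour-side e)

    Between : V → V → V → Set
    Between i j t = t ∈ A × P i < P t × P t < P j

    Spanning : V → V → Set
    Spanning i j = i ∈ A × j ∈ A × Edge G i j × P i < P j × ∃ (Between i j)

    RightNeighbour : V → Set
    RightNeighbour t = ∃ λ s → s ∈ A × Edge G t s × P t < P s

    right-neighbour? : ∀ t → Dec (RightNeighbour t)
    right-neighbour? t = any? λ s → s ∈? A ×-dec T? (adj G t s) ×-dec P t <? P s

    between? : ∀ i j t → Dec (Between i j t)
    between? i j t = t ∈? A ×-dec P i <? P t ×-dec P t <? P j

    spanning? : ∀ i j → Dec (Spanning i j)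
    spanning? i j = i ∈? A ×-dec j ∈? A ×-dec T? (adj G i j) ×-dec P i <? P j ×-dec any? (between? i j)

    right-neighbour-unique : ∀ {t} → t ∈ A → (∀ {s} → s ∈ A → Edge G t s → P t < P s → ¬ Spanning t s) →
      ∀ {s₁ s₂} → s₁ ∈ A → s₂ ∈ A → Edge G t s₁ → Edge G t s₂ → P t < P s₁ → P t < P s₂ → s₁ ≡ s₂
    right-neighbour-unique t∈A short {s₁} {s₂} s₁∈A s₂∈A e₁ e₂ t<s₁ t<s₂ with <-cmp (P s₁) (P s₂)
    ... | tri< s₁<s₂ _ _ = ⊥-elim (short s₂∈A e₂ t<s₂ (t∈A , s₂∈A , e₂ , t<s₂ , s₁ , s₁∈A , t<s₁ , s₁<s₂))
    ... | tri≈ _ s₁≡s₂ _ = P-injective s₁≡s₂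
    ... | tri> _ _ s₂<s₁ = ⊥-elim (short s₁∈A e₁ t<s₁ (t∈A , s₁∈A , e₁ , t<s₁ , s₂ , s₂∈A , t<s₂ , s₂<s₁))

    left-neighbour-unique : ∀ {t} → t ∈ A → (∀ {s} → s ∈ A → Edge G s t → P s < P t → ¬ Spanning s t) →
      ∀ {s₁ s₂} → s₁ ∈ A → s₂ ∈ A → Edge G t s₁ → Edge G t s₂ → P s₁ < P t → P s₂ < P t → s₁ ≡ s₂
    left-neighbour-unique t∈A short {s₁} {s₂} s₁∈A s₂∈A e₁ e₂ s₁<t s₂<t with <-cmp (P s₁) (P s₂)
    ... | tri< s₁<s₂ _ _ =
      ⊥-elim (short s₁∈A (Edge-sym G e₁) s₁<t (s₁∈A , t∈A , Edge-sym G e₁ , s₁<t , s₂ , s₂∈A , s₁<s₂ , s₂<t))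
    ... | tri≈ _ s₁≡s₂ _ = P-injective s₁≡s₂
    ... | tri> _ _ s₂<s₁ =
      ⊥-elim (short s₂∈A (Edge-sym G e₂) s₂<t (s₂∈A , t∈A , Edge-sym G e₂ , s₂<t , s₁ , s₁∈A , s₂<s₁ , s₁<t))

    leftmost-reduction : (∀ {i j} → ¬ Spanning i j) → ∀ {z} → z ∈ A → Reduction G A
    leftmost-reduction none z∈A with minimal P (λ v → any? λ s → s ∈? A ×-dec P s <? P v) z∈A
    ... | z₀ , z₀∈A , leftmost = reduce (right-neighbour? z₀)
      where
      rightward : ∀ {s} → s ∈ A → Edge G z₀ s → P z₀ < P s
      rightward s∈A e = ≤∧≢⇒< (leftmost s∈A) (Edge-irrefl G e ∘ P-injective)

      reduce : Dec (RightNeighbour z₀) → Reduction G A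
      reduce (no ∄) = pendant {m = z₀} z₀∈A λ s∈A e → ⊥-elim (∄ (_ , s∈A , e , rightward s∈A e))
      reduce (yes (m , m∈A , z₀∼m , z₀<m)) = pendant z₀∈A λ s∈A e →
        right-neighbour-unique z₀∈A (λ _ _ _ → none) s∈A m∈A e z₀∼m (rightward s∈A e) z₀<m

    -- Edges at vertices under ij are nested in ij, hence shorter, hence pass over nothing:
    -- such a vertex has at most one neighbour on each side.
    module Innermost {i j t} (i∈A : i ∈ A) (i∼j : Edge G i j)
      (shortest : ∀ {k l} → Spanning k l → P j ∸ P i ≤ P l ∸ P k)
      (t∈A : t ∈ A) (i<t : P i < P t) (t<j : P t < P j) (leftmost : ∀ {s} → Between i j s → P t ≤ P s) where

      nested-nonspanning : ∀ {k l} → P i ≤ P k → P l ≤ P j → P i < P k ⊎ P l < P j → ¬ Spanning k l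
      nested-nonspanning i≤k l≤j proper kl@(_ , _ , _ , k<l , _) =
        <⇒≱ (nested-interval-shorter i≤k l≤j proper k<l) (shortest kl)

      inner-right-unique : ∀ {c} → Between i j c →
        ∀ {s₁ s₂} → s₁ ∈ A → s₂ ∈ A → Edge G c s₁ → Edge G c s₂ → P c < P s₁ → P c < P s₂ → s₁ ≡ s₂
      inner-right-unique (c∈A , i<c , c<j) = right-neighbour-unique c∈A λ _ c∼s _ →
        nested-nonspanning (<⇒≤ i<c) (proj₂ (under-chord i∼j i<c c<j c∼s)) (inj₁ i<c)

      inner-left-unique : ∀ {c} → Between i j c →
        ∀ {s₁ s₂} → s₁ ∈ A → s₂ ∈ A → Edge G c s₁ → Edge G c s₂ → P s₁ < P c → P s₂ < P c → s₁ ≡ s₂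
      inner-left-unique (c∈A , i<c , c<j) = left-neighbour-unique c∈A λ _ s∼c _ →
        nested-nonspanning (proj₁ (under-chord i∼j i<c c<j (Edge-sym G s∼c))) (<⇒≤ c<j) (inj₂ c<j)

      t-left : ∀ {s} → s ∈ A → Edge G t s → P s < P t → s ≡ i
      t-left {s} s∈A t∼s s<t with <-cmp (P i) (P s)
      ... | tri< i<s _ _ = ⊥-elim (<⇒≱ s<t (leftmost (s∈A , i<s , <-trans s<t t<j)))
      ... | tri≈ _ i≡s _ = ≡-sym (P-injective i≡s)
      ... | tri> _ _ s<i = ⊥-elim (<⇒≱ s<i (proj₁ (under-chord i∼j i<t t<j t∼s)))

      t-right : ∀ {s₁ s₂} → s₁ ∈ A → s₂ ∈ A → Edge G t s₁ → Edge G t s₂ → P t < P s₁ → P t < P s₂ → s₁ ≡ s₂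
      t-right = inner-right-unique (t∈A , i<t , t<j)

      second-reduction : ¬ HasTriangle G → Edge G t i → ∀ {r} → r ∈ A → Edge G t r → P t < P r → Reduction G A
      second-reduction △-free t∼i {r} r∈A t∼r t<r = reduce (right-neighbour? r)
        where
        r≢j : r ≢ j
        r≢j r≡j = △-free (i , t , j , Edge-sym G t∼i , subst (Edge G t) r≡j t∼r , i∼j)

        r-between : Between i j r
        r-between = r∈A , <-trans i<t t<r ,
          ≤∧≢⇒< (proj₂ (under-chord i∼j i<t t<j t∼r)) (r≢j ∘ P-injective)

        r-left : ∀ {s} → s ∈ A → Edge G r s → P s < P r → s ≡ t
        r-left s∈A r∼s s<r = inner-left-unique r-between s∈A t∈A r∼s (Edge-sym G t∼r) s<r t<r

        reduce : Dec (RightNeighbour r) → Reduction G A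
        reduce (no ∄) = pendant r∈A (by-side r-left λ s∈A e r<s → ⊥-elim (∄ (_ , s∈A , e , r<s)))
        reduce (yes (b , b∈A , r∼b , r<b)) = suspended record
          { u = t ; w = r ; a = i ; b = b
          ; u∈A = t∈A ; w∈A = r∈A ; a∈A = i∈A ; b∈A = b∈A
          ; edge-au = Edge-sym G t∼i ; edge-uw = t∼r ; edge-wb = r∼b
          ; a≢w = distinct (<-trans i<t t<r)
          ; b≢u = ≢-sym (distinct (<-trans t<r r<b))
          ; a≢b = distinct (<-trans (<-trans i<t t<r) r<b)
          ; neighbours-u = by-side (λ s∈A e s<t → inj₂ (t-left s∈A e s<t))
                                   (λ s∈A e t<s → inj₁ (t-right s∈A r∈A e t∼r t<s t<r))
          ; neighbours-w = by-side (λ s∈A e s<r → inj₁ (r-left s∈A e s<r))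
                                   (λ s∈A e r<s → inj₂ (inner-right-unique r-between s∈A b∈A e r∼b r<s r<b))
          }

      innermost-reduction : ¬ HasTriangle G → Reduction G A
      innermost-reduction △-free with right-neighbour? t
      ... | no ∄ = pendant t∈A (by-side t-left λ s∈A e t<s → ⊥-elim (∄ (_ , s∈A , e , t<s)))
      ... | yes (r , r∈A , t∼r , t<r) with T? (adj G t i)
      ...   | yes t∼i = second-reduction △-free t∼i r∈A t∼r t<r
      ...   | no t≁i = pendant t∈A (by-side
        (λ s∈A e s<t → ⊥-elim (t≁i (subst (Edge G t) (t-left s∈A e s<t) e)))
        (λ s∈A e t<s → t-right s∈A r∈A e t∼r t<s t<r))

    length : V × V → ℕ
    length (i , j) = P j ∸ P i

    shorter-spanning? : ∀ e → Dec (∃ λ e′ → uncurry Spanning e′ × length e′ < length e)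
    shorter-spanning? e = map′ (λ { (k , l , kl) → (k , l) , kl }) (λ { ((k , l) , kl) → k , l , kl })
      (any? λ k → any? λ l → spanning? k l ×-dec length (k , l) <? length e)

    reduction : ¬ HasTriangle G → ∀ {z} → z ∈ A → Reduction G A
    reduction △-free z∈A with any? (λ i → any? (spanning? i))
    ... | no none = leftmost-reduction (λ ij → none (_ , _ , ij)) z∈A
    ... | yes (i₀ , j₀ , i₀j₀) with minimal length shorter-spanning? {i₀ , j₀} i₀j₀
    ...   | (i , j) , (i∈A , _ , i∼j , _ , t₀ , t₀-between) , shortest
      with minimal P (λ v → any? λ s → between? i j s ×-dec P s <? P v) t₀-between
    ...   | t , (t∈A , i<t , t<j) , leftmost =
      Innermost.innermost-reduction i∈A i∼j (λ {k} {l} → shortest {k , l}) t∈A i<t t<j leftmost △-free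

  reducible : ¬ HasTriangle G → Reducible G
  reducible △-free {A} = reduction A △-free

module _ (G : Graph) where

  one-colour-matching : (c : Coloring G 1) {F : EdgeSet G} → ProperlyColoured c F →
    ∀ {u v w} → T (mem F u v) → T (mem F u w) → v ≡ w
  one-colour-matching c {F} proper {u} {v} {w} uv∈F uw∈F = decidable-stable (v ≟ w) λ v≢w →
    proper u v w v≢w (mem-sub F u v uv∈F) (mem-sub F u w uw∈F) uv∈F uw∈F (Fin1-unique _ _)

  triangle⇒¬pd₁ : HasTriangle G → ¬ PDColourable G 1
  triangle⇒¬pd₁ (a , b , d , a∼b , b∼d , a∼d) (c , pd) with pd a b (Edge-irrefl G a∼b)
  ... | F , (_ , proper) , separates = separates (step (a∼d , ad∉F) (step (Edge-sym G b∼d , db∉F) here))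
    where
    ab∈F : T (mem F a b)
    ab∈F = decidable-stable (T? _) λ ab∉F → separates (step (a∼b , ab∉F) here)

    ad∉F : ¬ T (mem F a d)
    ad∉F ad∈F = Edge-irrefl G b∼d (one-colour-matching c {F} proper ab∈F ad∈F)

    db∉F : ¬ T (mem F d b)
    db∉F db∈F = Edge-irrefl G a∼d
      (one-colour-matching c {F} proper (subst T (mem-sym F a b) ab∈F) (subst T (mem-sym F d b) db∈F))

  no-0-colouring : Connected G → 2 ≤ n G → ¬ PDColourable G 0
  no-0-colouring connected 2≤n (c , _) with two-distinct 2≤n
  ... | x , y , x≢y with reach-edge (connected x y) x≢y
  ...   | u , v , e = ¬Fin0 (col c u v e)

  monochromatic : Coloring G 1
  monochromatic = record { col = λ _ _ _ → zero ; col-sym = λ _ _ _ _ → refl }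

  cut-of : (Fin (n G) → Bool) → EdgeSet G
  cut-of S = record
    { mem = λ u v → adj G u v ∧ (S u xor S v)
    ; mem-sym = λ u v → cong₂ _∧_ (Graph.sym G u v) (xor-comm (S u) (S v))
    ; mem-sub = λ _ _ → proj₁ ∘ Equivalence.to T-∧
    }

  private
    T-xor : ∀ {b c} → T (b xor c) → b ≢ c
    T-xor {true} {true} ()
    T-xor {false} {false} ()
    T-xor {true} {false} _ ()
    T-xor {false} {true} _ ()

    ¬T-xor : ∀ {b c} → ¬ T (b xor c) → b ≡ c
    ¬T-xor {true} {true} _ = refl
    ¬T-xor {false} {false} _ = refl
    ¬T-xor {true} {false} uncut = ⊥-elim (uncut _)
    ¬T-xor {false} {true} uncut = ⊥-elim (uncut _)

  reach-same-side : ∀ {S x y} → Reach (Minus G (cut-of S)) x y → S x ≡ S y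
  reach-same-side here = refl
  reach-same-side (step (e , uncut) r) =
    trans (¬T-xor (uncut ∘ Equivalence.from T-∧ ∘ (e ,_))) (reach-same-side r)

  separation⇒proper-cut : ∀ {x y} → Separation G ⊤ x y →
    Σ (EdgeSet G) λ F → ProperCut monochromatic F × Separates G F x y
  separation⇒proper-cut {x} {y} (S , Sx , Sy , cut) = cut-of S , ((x , y , separates) , proper) , separates
    where
    separates : Separates G (cut-of S) x y
    separates r = sides-differ Sx Sy (reach-same-side r)

    crossing : ∀ {u v} → T (mem (cut-of S) u v) → S u ≢ S v
    crossing = T-xor ∘ proj₂ ∘ Equivalence.to T-∧

    proper : ProperlyColoured monochromatic (cut-of S)
    proper u v w v≢w e₁ e₂ uv∈F uw∈F _ with cut (∈⊤ {x = u})
    ... | m , only = v≢w (trans (only ∈⊤ e₁ (crossing uv∈F)) (≡-sym (only ∈⊤ e₂ (crossing uw∈F))))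

  separable⇒pd₁ : Separable G ⊤ → PDColourable G 1
  separable⇒pd₁ separable = monochromatic , λ x y x≢y → separation⇒proper-cut (separable ∈⊤ ∈⊤ x≢y)

theorem3p8 : (G : Graph) → Connected G → Outerplanar G → 2 ≤ n G →
    PD≡ G 1 ⇔ (¬ HasTriangle G)
theorem3p8 G connected (pos , pos-injective , noncrossing) 2≤n = mk⇔
  (λ { (pd₁ , _) △ → triangle⇒¬pd₁ G △ pd₁ })
  (λ △-free → separable⇒pd₁ G (separable G (reducible △-free) ⊤) , fewer-colours)
  where
  open ConvexDrawing G (toℕ ∘ pos) (pos-injective ∘ toℕ-injective) (λ {a} {b} {c} {d} → noncrossing a b c d)

  fewer-colours : ∀ j → j < 1 → ¬ PDColourable G j
  fewer-colours .0 (s≤s z≤n) = no-0-colouring G connected 2≤n
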